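{- Let $n\ge 3$ and $k\ge 2$, and let $\mathcal{H}=(V,\mathcal{E})$ be a $k$-uniform hypergraph with $V=\{1,\dots,n\}$ and $EI(\mathcal{H})=C_n$. If $\mathcal{H}$ is $3$-regular, then $|\mathcal{E}|\le|\mathcal{E}'|$ for every $k$-uniform hypergraph $\mathcal{H}'=(V,\mathcal{E}')$ with $EI(\mathcal{H}')=C_n$; that is, $|\mathcal{E}|=\mu^k_n$.
   Context: Hypergraphs $\mathcal{H}=(V,\mathcal{E})$ have no multiple hyperedges (hyperedges form a set of subsets of $V$); isolated vertices are allowed. $\mathcal{H}$ is $k$-uniform if every hyperedge has exactly $k$ elements; the degree $d_{\mathcal{H}}(v)$ is the number of hyperedges containing $v$, and $\mathcal{H}$ is $r$-regular if every vertex has degree $r$. The edge intersection hypergraph of $\mathcal{H}$ is $EI(\mathcal{H})=(V,\mathcal{E}^{EI})$ with $\mathcal{E}^{EI}=\{e_1\cap e_2: e_1,e_2\in\mathcal{E},\ e_1\ne e_2,\ |e_1\cap e_2|\ge 2\}$. $C_n$ is the cycle with vertex set $\{1,\dots,n\}$ and edge set $\{\{i,i+1\}: i=1,\dots,n\}$ (indices mod $n$); "$EI(\mathcal{H})=C_n$" means $V=\{1,\dots,n\}$ and $\mathcal{E}^{EI}$ equals the edge set of $C_n$. $\mu^k_n$ denotes the minimum of $|\mathcal{E}|$ over all $k$-uniform hypergraphs $\mathcal{H}=(V,\mathcal{E})$ with $EI(\mathcal{H})=C_n$. -}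

module Defs where

open import Data.Nat using (ℕ; suc; _≤_)
open import Data.Fin using (Fin; toℕ)
open import Data.Fin.Subset using (Subset; _∩_; ∣_∣; _∈_)
open import Data.Fin.Subset.Properties using (_∈?_)
open import Data.List using (List; length; filter)
open import Data.List.Membership.Propositional using () renaming (_∈_ to _∈ₗ_)
open import Data.List.Relation.Unary.All using (All)
open import Data.List.Relation.Unary.Unique.Propositional using (Unique)
open import Data.Product using (Σ; _×_; ∃; ∃-syntax)
open import Data.Sum using (_⊎_)
open import Relation.Nullary using (¬_)
open import Relation.Binary.PropositionalEquality using (_≡_)
open import Function.Bundles using (_⇔_)

-- A hypergraph on vertex set Fin n ≅ {1,…,n}: a duplicate-free list of
-- hyperedges (subsets of the vertex set), i.e. a finite *set* of hyperedges.
record Hypergraph (n : ℕ) : Set where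
  constructor mkHypergraph
  field
    edges  : List (Subset n)
    unique : Unique edges

open Hypergraph public

numEdges : ∀ {n} → Hypergraph n → ℕ
numEdges H = length (edges H)

Uniform : ∀ {n} → ℕ → Hypergraph n → Set
Uniform k H = All (λ e → ∣ e ∣ ≡ k) (edges H)

degree : ∀ {n} → Hypergraph n → Fin n → ℕ
degree H v = length (filter (v ∈?_) (edges H))

Regular : ∀ {n} → ℕ → Hypergraph n → Set
Regular r H = ∀ v → degree H v ≡ r

IsEIEdge : ∀ {n} → Hypergraph n → Subset n → Set
IsEIEdge H S = ∃[ e₁ ] ∃[ e₂ ] (e₁ ∈ₗ edges H × e₂ ∈ₗ edges H × ¬ (e₁ ≡ e₂)
                                × S ≡ (e₁ ∩ e₂) × 2 ≤ ∣ S ∣)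

-- S is an edge {i, i+1 (mod n)} of the cycle C_n (vertex i ∈ Fin n stands for i+1)
IsCycleEdge : (n : ℕ) → Subset n → Set
IsCycleEdge n S = ∃ λ (i : Fin n) → (∀ (j : Fin n) → (j ∈ S) ⇔
  (toℕ j ≡ toℕ i ⊎ toℕ j ≡ suc (toℕ i) ⊎ (suc (toℕ i) ≡ n × toℕ j ≡ 0)))

EIisCycle : ∀ {n} → Hypergraph n → Set
EIisCycle {n} H = ∀ (S : Subset n) → IsEIEdge H S ⇔ IsCycleEdge n S

-- Count incidences: in a k-uniform hypergraph the degrees sum to k·|E|, so a
-- 3-regular one has k·|E| = 3n. If EI(H′) = C_n, every vertex w lies on the two
-- distinct cycle edges {w-1, w} and {w, w+1}; each is e₁ ∩ e₂ for two distinct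
-- hyperedges through w, and the two pairs cannot be the same pair, so at least
-- three hyperedges contain w. Hence k·|E′| ≥ 3n = k·|E|.
module Submission where

open import Defs
import Algebra.Properties.CommutativeMonoid.Sum as Sum
open import Algebra.Definitions using (Commutative)
open import Data.Bool using (true; false)
open import Data.Bool.Properties using () renaming (_≟_ to _≟ᵇ_)
open import Data.Fin using (Fin; zero; suc; toℕ; fromℕ; inject₁)
open import Data.Fin.Properties using (toℕ-fromℕ; toℕ-inject₁)
open import Data.Fin.Subset using (Subset; ∣_∣; _∈_; inside; outside)
open import Data.Fin.Subset.Properties using (_∈?_; ∩-comm; x∈p∩q⁻)
open import Data.List using (List; []; _∷_; [_]; _++_; length; filter)
open import Data.List.Membership.Propositional using () renaming (_∈_ to _∈ₗ_)
open import Data.List.Membership.Propositional.Properties using (∈-length; ∈-filter⁺)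
open import Data.List.Properties using (filter-++; length-++)
open import Data.List.Relation.Unary.All using (All; []; _∷_)
open import Data.List.Relation.Unary.Any using (here; there)
open import Data.Nat using (ℕ; zero; suc; _+_; _*_; _≤_; z≤n; s≤s; _≟_)
open import Data.Nat.Properties
  using (+-0-commutativeMonoid; +-mono-≤; *-suc; *-zeroʳ; *-cancelˡ-≤; m≤n⇒m≤1+n; m≢1+n+m; module ≤-Reasoning)
open import Data.Product using (_×_; _,_; proj₁; proj₂)
open import Data.Sum using (_⊎_; inj₁; inj₂)
open import Data.Vec using ([]; _∷_; tabulate)
open import Data.Vec.Functional using (Vector)
open import Data.Vec.Properties using (lookup∘tabulate; []=⇒lookup; lookup⇒[]=; ≡-dec)
open import Function using (_∘_)
open import Function.Bundles using (_⇔_; mk⇔; Equivalence)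
open import Relation.Binary.Definitions using (DecidableEquality)
open import Relation.Binary.PropositionalEquality
  using (_≡_; _≢_; refl; sym; trans; cong; cong₂; subst; module ≡-Reasoning)
open import Relation.Nullary using (¬_; yes; no; does; proof; contradiction)
open import Relation.Nullary.Reflects using (Reflects; invert)
open import Relation.Nullary.Decidable using (_⊎-dec_; _×-dec_; dec-true)
open import Relation.Unary using (Pred; Decidable)

open Sum +-0-commutativeMonoid using (sum; ∑-distrib-+; sum-cong-≗; sum-replicate-zero)

sum-mono-≤ : ∀ {n} {f g : Vector ℕ n} → (∀ i → f i ≤ g i) → sum f ≤ sum g
sum-mono-≤ {zero}  f≤g = z≤n
sum-mono-≤ {suc n} f≤g = +-mono-≤ (f≤g zero) (sum-mono-≤ (f≤g ∘ suc))

distinct₂⇒2≤length : ∀ {A : Set} {x y : A} {xs} → x ∈ₗ xs → y ∈ₗ xs → x ≢ y → 2 ≤ length xs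
distinct₂⇒2≤length (here refl) (here refl) x≢y = contradiction refl x≢y
distinct₂⇒2≤length (here refl) (there y∈) _   = s≤s (∈-length y∈)
distinct₂⇒2≤length (there x∈) (here refl) _   = s≤s (∈-length x∈)
distinct₂⇒2≤length (there x∈) (there y∈) x≢y = m≤n⇒m≤1+n (distinct₂⇒2≤length x∈ y∈ x≢y)

distinct₃⇒3≤length : ∀ {A : Set} {x y z : A} {xs} → x ∈ₗ xs → y ∈ₗ xs → z ∈ₗ xs →
                     x ≢ y → x ≢ z → y ≢ z → 3 ≤ length xs
distinct₃⇒3≤length (here refl) (here refl) _ x≢y _ _ = contradiction refl x≢y
distinct₃⇒3≤length (here refl) _ (here refl) _ x≢z _ = contradiction refl x≢z
distinct₃⇒3≤length _ (here refl) (here refl) _ _ y≢z = contradiction refl y≢z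
distinct₃⇒3≤length (here refl) (there y∈) (there z∈) _ _ y≢z = s≤s (distinct₂⇒2≤length y∈ z∈ y≢z)
distinct₃⇒3≤length (there x∈) (here refl) (there z∈) _ x≢z _ = s≤s (distinct₂⇒2≤length x∈ z∈ x≢z)
distinct₃⇒3≤length (there x∈) (there y∈) (here refl) x≢y _ _ = s≤s (distinct₂⇒2≤length x∈ y∈ x≢y)
distinct₃⇒3≤length (there x∈) (there y∈) (there z∈) x≢y x≢z y≢z =
  m≤n⇒m≤1+n (distinct₃⇒3≤length x∈ y∈ z∈ x≢y x≢z y≢z)

fresh-factor : ∀ {A : Set} {_∙_ : A → A → A} → DecidableEquality A → Commutative _≡_ _∙_ →
               ∀ {a b c d} → c ≢ d → a ∙ b ≢ c ∙ d →
               (c ≢ a × c ≢ b) ⊎ (d ≢ a × d ≢ b)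
fresh-factor _≟ₐ_ comm {a} {b} {c} {d} c≢d ab≢cd with c ≟ₐ a | c ≟ₐ b
... | no c≢a   | no c≢b   = inj₁ (c≢a , c≢b)
... | yes refl | _        = inj₂ (c≢d ∘ sym , λ { refl → ab≢cd refl })
... | no _     | yes refl = inj₂ ((λ { refl → ab≢cd (comm a b) }) , c≢d ∘ sym)

subsetOf : ∀ {n ℓ} {P : Pred (Fin n) ℓ} → Decidable P → Subset n
subsetOf P? = tabulate (does ∘ P?)

∈-subsetOf : ∀ {n ℓ} {P : Pred (Fin n) ℓ} {P? : Decidable P} {i} → i ∈ subsetOf P? ⇔ P i
∈-subsetOf {P? = P?} {i} = mk⇔
  (λ i∈ → invert (subst (Reflects _) (trans (sym (lookup∘tabulate _ i)) ([]=⇒lookup i∈)) (proof (P? i))))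
  (λ Pi → lookup⇒[]= i _ (trans (lookup∘tabulate _ i) (dec-true (P? i) Pi)))

degreeIn : ∀ {n} → List (Subset n) → Fin n → ℕ
degreeIn L v = length (filter (v ∈?_) L)

degreeIn-∷ : ∀ {n} e (L : List (Subset n)) v → degreeIn (e ∷ L) v ≡ degreeIn [ e ] v + degreeIn L v
degreeIn-∷ e L v = begin
  length (filter (v ∈?_) ([ e ] ++ L))               ≡⟨ cong length (filter-++ (v ∈?_) [ e ] L) ⟩
  length (filter (v ∈?_) [ e ] ++ filter (v ∈?_) L) ≡⟨ length-++ (filter (v ∈?_) [ e ]) ⟩
  degreeIn [ e ] v + degreeIn L v                    ∎
  where open ≡-Reasoning

degreeIn-[∷]-suc : ∀ {n} s (p : Subset n) v → degreeIn [ s ∷ p ] (suc v) ≡ degreeIn [ p ] v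
degreeIn-[∷]-suc s p v with does (v ∈? p)
... | true  = refl
... | false = refl

∑-degreeIn-[_] : ∀ {n} (e : Subset n) → sum (degreeIn [ e ]) ≡ ∣ e ∣
∑-degreeIn-[ [] ]          = refl
∑-degreeIn-[ inside ∷ p ]  = cong suc (trans (sum-cong-≗ (degreeIn-[∷]-suc inside p)) ∑-degreeIn-[ p ])
∑-degreeIn-[ outside ∷ p ] = trans (sum-cong-≗ (degreeIn-[∷]-suc outside p)) ∑-degreeIn-[ p ]

∑-degreeIn-uniform : ∀ {n k} (L : List (Subset n)) → All (λ e → ∣ e ∣ ≡ k) L →
                     sum (degreeIn L) ≡ k * length L
∑-degreeIn-uniform {n} {k} [] [] = trans (sum-replicate-zero n) (sym (*-zeroʳ k))
∑-degreeIn-uniform {k = k} (e ∷ L) (∣e∣≡k ∷ uniform) = begin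
  sum (degreeIn (e ∷ L))                      ≡⟨ sum-cong-≗ (degreeIn-∷ e L) ⟩
  sum (λ v → degreeIn [ e ] v + degreeIn L v) ≡⟨ ∑-distrib-+ (degreeIn [ e ]) (degreeIn L) ⟩
  sum (degreeIn [ e ]) + sum (degreeIn L)     ≡⟨ cong₂ _+_ (trans ∑-degreeIn-[ e ] ∣e∣≡k)
                                                            (∑-degreeIn-uniform L uniform) ⟩
  k + k * length L                            ≡⟨ *-suc k (length L) ⟨
  k * suc (length L)                          ∎
  where open ≡-Reasoning

3≤degree-on-two-EIEdges : ∀ {n} (H : Hypergraph n) {S T w} → IsEIEdge H S → IsEIEdge H T →
                          S ≢ T → w ∈ S → w ∈ T → 3 ≤ degree H w
3≤degree-on-two-EIEdges H {w = w} (a , b , a∈H , b∈H , a≢b , S≡a∩b , _)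
                                  (c , d , c∈H , d∈H , c≢d , T≡c∩d , _) S≢T w∈S w∈T =
  three-through (fresh-factor (≡-dec _≟ᵇ_) ∩-comm c≢d
                  (λ a∩b≡c∩d → S≢T (trans S≡a∩b (trans a∩b≡c∩d (sym T≡c∩d)))))
  where
  through : ∀ {e} → e ∈ₗ edges H → w ∈ e → e ∈ₗ filter (w ∈?_) (edges H)
  through = ∈-filter⁺ (w ∈?_)
  w∈a = proj₁ (x∈p∩q⁻ a b (subst (w ∈_) S≡a∩b w∈S))
  w∈b = proj₂ (x∈p∩q⁻ a b (subst (w ∈_) S≡a∩b w∈S))
  w∈c = proj₁ (x∈p∩q⁻ c d (subst (w ∈_) T≡c∩d w∈T))
  w∈d = proj₂ (x∈p∩q⁻ c d (subst (w ∈_) T≡c∩d w∈T))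
  three-through : (c ≢ a × c ≢ b) ⊎ (d ≢ a × d ≢ b) → 3 ≤ degree H w
  three-through (inj₁ (c≢a , c≢b)) =
    distinct₃⇒3≤length (through a∈H w∈a) (through b∈H w∈b) (through c∈H w∈c) a≢b (c≢a ∘ sym) (c≢b ∘ sym)
  three-through (inj₂ (d≢a , d≢b)) =
    distinct₃⇒3≤length (through a∈H w∈a) (through b∈H w∈b) (through d∈H w∈d) a≢b (d≢a ∘ sym) (d≢b ∘ sym)

InCycleEdge : ∀ n → Fin n → Fin n → Set
InCycleEdge n i j = toℕ j ≡ toℕ i ⊎ toℕ j ≡ suc (toℕ i) ⊎ (suc (toℕ i) ≡ n × toℕ j ≡ 0)

inCycleEdge? : ∀ {n} (i : Fin n) → Decidable (InCycleEdge n i)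
inCycleEdge? {n} i j =
  (toℕ j ≟ toℕ i) ⊎-dec ((toℕ j ≟ suc (toℕ i)) ⊎-dec ((suc (toℕ i) ≟ n) ×-dec (toℕ j ≟ 0)))

cycleEdge : ∀ {n} → Fin n → Subset n
cycleEdge i = subsetOf (inCycleEdge? i)

∈-cycleEdge : ∀ {n} {i j : Fin n} → j ∈ cycleEdge i ⇔ InCycleEdge n i j
∈-cycleEdge {i = i} = ∈-subsetOf {P? = inCycleEdge? i}

cycleEdge-isCycleEdge : ∀ {n} (i : Fin n) → IsCycleEdge n (cycleEdge i)
cycleEdge-isCycleEdge i = i , λ j → ∈-cycleEdge

cyclicPred : ∀ {n} → Fin (suc n) → Fin (suc n)
cyclicPred {n} zero = fromℕ n
cyclicPred (suc j)  = inject₁ j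

inCycleEdge-cyclicPred : ∀ {n} (w : Fin (suc n)) → InCycleEdge (suc n) (cyclicPred w) w
inCycleEdge-cyclicPred {n} zero = inj₂ (inj₂ (cong suc (toℕ-fromℕ n) , refl))
inCycleEdge-cyclicPred (suc j)  = inj₂ (inj₁ (cong suc (sym (toℕ-inject₁ j))))

cyclicPred-∉-cycleEdge : ∀ {n} → 2 ≤ n → (w : Fin (suc n)) → ¬ InCycleEdge (suc n) w (cyclicPred w)
cyclicPred-∉-cycleEdge (s≤s (s≤s _)) zero = λ { (inj₁ ()) ; (inj₂ (inj₁ ())) ; (inj₂ (inj₂ (() , _))) }
cyclicPred-∉-cycleEdge (s≤s (s≤s _)) (suc j) rewrite toℕ-inject₁ j = λ
  { (inj₁ j≡1+j)                → m≢1+n+m (toℕ j) j≡1+j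
  ; (inj₂ (inj₁ j≡2+j))         → m≢1+n+m (toℕ j) j≡2+j
  ; (inj₂ (inj₂ (2+j≡n , j≡0))) → contradiction (trans (cong (2 +_) (sym j≡0)) 2+j≡n) λ ()
  }

3≤degree-of-EIisCycle : ∀ {n} → 3 ≤ n → (H : Hypergraph n) → EIisCycle H → ∀ w → 3 ≤ degree H w
3≤degree-of-EIisCycle (s≤s 2≤n) H ei w =
  3≤degree-on-two-EIEdges H (isEIEdge w) (isEIEdge (cyclicPred w)) edges-differ
    (Equivalence.from ∈-cycleEdge (inj₁ refl)) (Equivalence.from ∈-cycleEdge (inCycleEdge-cyclicPred w))
  where
  isEIEdge : ∀ i → IsEIEdge H (cycleEdge i)
  isEIEdge i = Equivalence.from (ei (cycleEdge i)) (cycleEdge-isCycleEdge i)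
  edges-differ : cycleEdge w ≢ cycleEdge (cyclicPred w)
  edges-differ eq = cyclicPred-∉-cycleEdge 2≤n w (Equivalence.to ∈-cycleEdge
    (subst (cyclicPred w ∈_) (sym eq) (Equivalence.from ∈-cycleEdge (inj₁ refl))))

theorem1 : ∀ (n k : ℕ) → 3 ≤ n → 2 ≤ k → (H : Hypergraph n) →
    Uniform k H → EIisCycle H → Regular 3 H →
    ∀ (H′ : Hypergraph n) → Uniform k H′ → EIisCycle H′ →
    numEdges H ≤ numEdges H′
theorem1 n k 3≤n (s≤s (s≤s _)) H uniform _ regular H′ uniform′ ei′ = *-cancelˡ-≤ k (begin
  k * numEdges H    ≡⟨ ∑-degreeIn-uniform (edges H) uniform ⟨
  sum (degree H)    ≡⟨ sum-cong-≗ regular ⟩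
  sum {n} (λ _ → 3) ≤⟨ sum-mono-≤ (3≤degree-of-EIisCycle 3≤n H′ ei′) ⟩
  sum (degree H′)   ≡⟨ ∑-degreeIn-uniform (edges H′) uniform′ ⟩
  k * numEdges H′   ∎)
  where open ≤-Reasoning
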